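{- Let $\Theta$ be a branch of a tableau of $\mathbf{TAB}_{\mathbf{IB}}$. For every formula $@_i\varphi\in\Theta$, at least one of the following holds: (a) $@_i\varphi$ is a quasi-subformula of the root formula of $\Theta$; (b) $@_i\varphi$ is an accessibility formula; (c) $@_i\varphi$ is a quasi-subformula of $@_j\neg\diamondsuit j$ for some nominal $j$ occurring in $\Theta$.
   Context: Hybrid language: fix disjoint countably infinite sets $\mathbf{Prop}$ (propositional variables) and $\mathbf{Nom}$ (nominals). Formulas: $\varphi ::= p \mid i \mid \neg\varphi \mid \varphi\land\varphi \mid \diamondsuit\varphi \mid @_i\varphi$ with $p\in\mathbf{Prop}$, $i\in\mathbf{Nom}$; $\square\varphi$ abbreviates $\neg\diamondsuit\neg\varphi$. Tableaux of $\mathbf{TAB}_{\mathbf{IB}}$: a tableau is a well-founded tree of formulas of the form $@_i\varphi$, started from a root formula $@_i\varphi$ where $i$ does not occur in $\varphi$. Each branch (maximal path) is extended by applying the rules below as often as possible, except that nothing more is added to a branch once it is closed, or once every formula that any rule could generate already occurs on it. A branch $\Theta$ is closed if $@_i\varphi, @_i\neg\varphi\in\Theta$ for some $i,\varphi$. Rules (premises already on the branch, conclusions added to it): [$\neg\neg$] from $@_i\neg\neg\varphi$ add $@_i\varphi$; [$\land$] from $@_i(\varphi\land\psi)$ add $@_i\varphi$ and $@_i\psi$; [$\neg\land$] from $@_i\neg(\varphi\land\psi)$ split the branch into one branch with $@_i\neg\varphi$ and one with $@_i\neg\psi$; [$\diamondsuit$] from $@_i\diamondsuit\varphi$ add $@_i\diamondsuit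 j$ and $@_j\varphi$, where $j$ is a nominal not yet occurring on the branch, the rule is applied at most once per formula, the premise is not an accessibility formula, and (restriction $\mathcal{D}$) $i$ is a quasi-urfather on the branch; [$\neg\diamondsuit$] from $@_i\neg\diamondsuit\varphi$ and $@_i\diamondsuit j$ add $@_j\neg\varphi$; [$@$] from $@_i@_j\varphi$ add $@_j\varphi$; [$\neg@$] from $@_i\neg@_j\varphi$ add $@_j\neg\varphi$; [$\mathit{Id}$] from $@_i\varphi$ and $@_i j$ add $@_j\varphi$, provided $@_i\varphi$ is not an accessibility formula; [$\mathit{Ref}$] add $@_i i$ for any nominal $i$ occurring on the branch; [$\square_{\mathit{sym}}$] from $@_i\square\varphi$ and $@_j\diamondsuit i$ add $@_j\varphi$; ($\mathcal{I}$) for every nominal $i$ occurring on the branch add $@_i\neg\diamondsuit i$. An accessibility formula is a formula $@_i\diamondsuit j$ added by [$\diamondsuit$] with $j$ new. Auxiliary notions for a branch $\Theta$: $@_i\varphi$ is a quasi-subformula of $@_j\psi$ if $\varphi$ is a subformula of $\psi$, or $\varphi=\neg\chi$ with $\chi$ a subformula of $\psi$. $T^\Theta(i)=\{\varphi \mid @_i\varphi\in\Theta$ and $@_i\varphi$ is a quasi-subformula of the root formula$\}$. Nominals $i,j$ are twins in $\Theta$ if $T^\Theta(i)=T^\Theta(j)$. $i\prec_\Theta j$ if $j$ was introduced by applying [$\diamondsuit$] to a formula $@_i\diamondsuit\varphi$; $\prec_\Theta^*$ is its reflexive transitive closure. A nominal $i$ is a quasi-urfather on $\Theta$ if there are no twins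 $j\neq k$ with $j\prec_\Theta^* i$ and $k\prec_\Theta^* i$. -}

module Defs where

open import Data.Nat using (ℕ)
open import Data.Product using (Σ; ∃; _×_; _,_)
open import Data.Sum using (_⊎_)
open import Data.List using (List; []; _∷_; _++_; map)
open import Data.List.Relation.Unary.All using (All)
open import Data.List.Membership.Propositional using (_∈_)
open import Relation.Nullary using (¬_)
open import Relation.Binary.PropositionalEquality using (_≡_; _≢_)
open import Relation.Binary.Construct.Closure.ReflexiveTransitive using (Star)

-- Hybrid formulas.  Prop and Nom are both copies of ℕ, kept disjoint by
-- using different constructors.

data Form : Set where
  prop : ℕ → Form
  nom  : ℕ → Form
  ¬'_  : Form → Form
  _∧'_ : Form → Form → Form
  ◇_   : Form → Form
  at   : ℕ → Form → Form

infixr 7 ¬'_ ◇_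
infixr 6 _∧'_

□_ : Form → Form
□ φ = ¬' ◇ ¬' φ

-- Tableau formulas are all of the form @_i φ; represented as the pair (i , φ).
SatF : Set
SatF = ℕ × Form

data _⊑_ : Form → Form → Set where
  ⊑-refl : ∀ {φ} → φ ⊑ φ
  ⊑-¬    : ∀ {φ ψ} → φ ⊑ ψ → φ ⊑ (¬' ψ)
  ⊑-∧ˡ   : ∀ {φ ψ χ} → φ ⊑ ψ → φ ⊑ (ψ ∧' χ)
  ⊑-∧ʳ   : ∀ {φ ψ χ} → φ ⊑ χ → φ ⊑ (ψ ∧' χ)
  ⊑-◇    : ∀ {φ ψ} → φ ⊑ ψ → φ ⊑ (◇ ψ)
  ⊑-at    : ∀ {φ ψ i} → φ ⊑ ψ → φ ⊑ at i ψ

QSub : SatF → SatF → Set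
QSub (i , φ) (j , ψ) = φ ⊑ ψ ⊎ Σ Form (λ χ → φ ≡ ¬' χ × χ ⊑ ψ)

data Occurs (n : ℕ) : Form → Set where
  oc-nom  : Occurs n (nom n)
  oc-¬    : ∀ {φ} → Occurs n φ → Occurs n (¬' φ)
  oc-∧ˡ   : ∀ {φ ψ} → Occurs n φ → Occurs n (φ ∧' ψ)
  oc-∧ʳ   : ∀ {φ ψ} → Occurs n ψ → Occurs n (φ ∧' ψ)
  oc-◇    : ∀ {φ} → Occurs n φ → Occurs n (◇ φ)
  oc-at    : ∀ {φ} → Occurs n (at n φ)
  oc-atin  : ∀ {i φ} → Occurs n φ → Occurs n (at i φ)

-- A branch is the list of its nodes, in the order added.
-- A node is either an ordinary formula, or an accessibility formula
-- @_i ◇ j introduced by [◇] applied to the premise @_i ◇ φ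
-- (recorded as  acc i j φ).

data Node : Set where
  plain : SatF → Node
  acc   : ℕ → ℕ → Form → Node

fml : Node → SatF
fml (plain f)   = f
fml (acc i j φ) = (i , ◇ nom j)

Branch : Set
Branch = List Node

_∈Θ_ : SatF → Branch → Set
f ∈Θ Θ = f ∈ map fml Θ

IsAcc : Branch → SatF → Set
IsAcc Θ f = Σ ℕ λ i → Σ ℕ λ j → Σ Form λ φ → acc i j φ ∈ Θ × f ≡ (i , ◇ nom j)

OccΘ : ℕ → Branch → Set
OccΘ n Θ = Σ ℕ λ k → Σ Form λ ψ → (k , ψ) ∈Θ Θ × (n ≡ k ⊎ Occurs n ψ)

Closed : Branch → Set
Closed Θ = Σ ℕ λ i → Σ Form λ φ → (i , φ) ∈Θ Θ × (i , ¬' φ) ∈Θ Θ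

T : SatF → Branch → ℕ → Form → Set
T r Θ i φ = (i , φ) ∈Θ Θ × QSub (i , φ) r

Twins : SatF → Branch → ℕ → ℕ → Set
Twins r Θ i j = ∀ φ → (T r Θ i φ → T r Θ j φ) × (T r Θ j φ → T r Θ i φ)

Prec : Branch → ℕ → ℕ → Set
Prec Θ i j = Σ Form λ φ → acc i j φ ∈ Θ

QuasiUrfather : SatF → Branch → ℕ → Set
QuasiUrfather r Θ i =
  ∀ j k → j ≢ k → Star (Prec Θ) j i → Star (Prec Θ) k i → ¬ Twins r Θ j k

data Concl : Set where
  one   : List Node → Concl
  split : SatF → SatF → Concl

data Rule (r : SatF) (Θ : Branch) : Concl → Set where
  r-¬¬  : ∀ {i φ} → (i , ¬' ¬' φ) ∈Θ Θ → Rule r Θ (one (plain (i , φ) ∷ []))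
  r-∧   : ∀ {i φ ψ} → (i , φ ∧' ψ) ∈Θ Θ →
          Rule r Θ (one (plain (i , φ) ∷ plain (i , ψ) ∷ []))
  r-¬∧  : ∀ {i φ ψ} → (i , ¬' (φ ∧' ψ)) ∈Θ Θ →
          Rule r Θ (split (i , ¬' φ) (i , ¬' ψ))
  r-◇   : ∀ {i j φ} → (i , ◇ φ) ∈Θ Θ →
          ¬ OccΘ j Θ →
          (∀ k → ¬ acc i k φ ∈ Θ) →
          ¬ IsAcc Θ (i , ◇ φ) →
          QuasiUrfather r Θ i →
          Rule r Θ (one (acc i j φ ∷ plain (j , φ) ∷ []))
  r-¬◇  : ∀ {i j φ} → (i , ¬' ◇ φ) ∈Θ Θ → (i , ◇ nom j) ∈Θ Θ →
          Rule r Θ (one (plain (j , ¬' φ) ∷ []))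
  r-at   : ∀ {i j φ} → (i , at j φ) ∈Θ Θ → Rule r Θ (one (plain (j , φ) ∷ []))
  r-¬at  : ∀ {i j φ} → (i , ¬' at j φ) ∈Θ Θ → Rule r Θ (one (plain (j , ¬' φ) ∷ []))
  r-Id  : ∀ {i j φ} → (i , φ) ∈Θ Θ → (i , nom j) ∈Θ Θ → ¬ IsAcc Θ (i , φ) →
          Rule r Θ (one (plain (j , φ) ∷ []))
  r-Ref : ∀ {i} → OccΘ i Θ → Rule r Θ (one (plain (i , nom i) ∷ []))
  r-□sym : ∀ {i j φ} → (i , □ φ) ∈Θ Θ → (j , ◇ nom i) ∈Θ Θ →
          Rule r Θ (one (plain (j , φ) ∷ []))
  r-I   : ∀ {i} → OccΘ i Θ → Rule r Θ (one (plain (i , ¬' ◇ nom i) ∷ []))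

data Ext (r : SatF) (Θ : Branch) : Branch → Set where
  ext-one : ∀ {ns} → ¬ Closed Θ → Rule r Θ (one ns) →
            ¬ All (λ n → fml n ∈Θ Θ) ns → Ext r Θ (Θ ++ ns)
  ext-l   : ∀ {f g} → ¬ Closed Θ → Rule r Θ (split f g) →
            ¬ f ∈Θ Θ → ¬ g ∈Θ Θ → Ext r Θ (Θ ++ plain f ∷ [])
  ext-r   : ∀ {f g} → ¬ Closed Θ → Rule r Θ (split f g) →
            ¬ f ∈Θ Θ → ¬ g ∈Θ Θ → Ext r Θ (Θ ++ plain g ∷ [])

data Path (r : SatF) : Branch → Set where
  start : Path r (plain r ∷ [])
  step  : ∀ {Θ Θ'} → Path r Θ → Ext r Θ Θ' → Path r Θ'

Saturated : SatF → Branch → Set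
Saturated r Θ =
  (∀ {ns} → Rule r Θ (one ns) → All (λ n → fml n ∈Θ Θ) ns) ×
  (∀ {f g} → Rule r Θ (split f g) → f ∈Θ Θ ⊎ g ∈Θ Θ)

IsBranch : SatF → Branch → Set
IsBranch r Θ = Path r Θ × (Closed Θ ⊎ Saturated r Θ)

-- Apart from the accessibility formula created by [◇], every conclusion of [¬¬], [∧],
-- [¬∧], [◇], [¬◇], [@], [¬@], [□sym] and [Id] is a subformula of one premise, or the
-- negation of a subformula where that premise is negated; so a quasi-subformula
-- relation explaining the premise also explains the conclusion. That premise is never
-- an accessibility formula: it does not have the shape @_i ◇ j, except for [◇] and
-- [Id], whose side conditions exclude it. The conclusions @_i i of [Ref] and @_i ¬◇ i
-- of (I) are quasi-subformulas of @_i ¬◇ i. So the three cases of the statement form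
-- an invariant along every path from the root.
module Submission where

open import Defs
open import Data.Nat using (ℕ)
open import Data.Product using (Σ; _×_; _,_; proj₁; proj₂)
open import Data.Sum using (_⊎_; inj₁; inj₂)
open import Data.Empty using (⊥-elim)
open import Data.List using (_++_)
open import Data.List.Relation.Unary.All as All using (All; []; _∷_)
import Data.List.Relation.Unary.All.Properties as All
open import Data.List.Relation.Unary.Any using (here)
open import Data.List.Relation.Binary.Subset.Propositional using (_⊆_)
open import Data.List.Relation.Binary.Subset.Propositional.Properties as ⊆ using (xs⊆xs++ys)
open import Data.List.Membership.Propositional.Properties using (∈-++⁺ʳ)
open import Function using (_∘_; id)
open import Relation.Nullary using (¬_)
open import Relation.Binary.PropositionalEquality using (_≡_; refl)

⊑-trans : ∀ {φ ψ χ} → φ ⊑ ψ → ψ ⊑ χ → φ ⊑ χ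
⊑-trans p ⊑-refl   = p
⊑-trans p (⊑-¬ q)  = ⊑-¬ (⊑-trans p q)
⊑-trans p (⊑-∧ˡ q) = ⊑-∧ˡ (⊑-trans p q)
⊑-trans p (⊑-∧ʳ q) = ⊑-∧ʳ (⊑-trans p q)
⊑-trans p (⊑-◇ q)  = ⊑-◇ (⊑-trans p q)
⊑-trans p (⊑-at q) = ⊑-at (⊑-trans p q)

-- QSub (i , φ) (j , ψ) unfolds to φ ≼ ψ.
infix 4 _≼_

_≼_ : Form → Form → Set
φ ≼ ψ = φ ⊑ ψ ⊎ Σ Form (λ χ → φ ≡ ¬' χ × χ ⊑ ψ)

¬≼⇒⊑ : ∀ {φ ψ} → ¬' φ ≼ ψ → φ ⊑ ψ
¬≼⇒⊑ (inj₁ p)              = ⊑-trans (⊑-¬ ⊑-refl) p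
¬≼⇒⊑ (inj₂ (_ , refl , p)) = p

⊑-≼-trans : ∀ {φ ψ χ} → φ ⊑ ψ → ψ ≼ χ → φ ≼ χ
⊑-≼-trans p (inj₁ q)                     = inj₁ (⊑-trans p q)
⊑-≼-trans ⊑-refl (inj₂ (χ , refl , q))  = inj₂ (χ , refl , q)
⊑-≼-trans (⊑-¬ p) (inj₂ (_ , refl , q)) = inj₁ (⊑-trans p q)

⊑-¬≼-trans : ∀ {φ ψ χ} → φ ⊑ ψ → ¬' ψ ≼ χ → ¬' φ ≼ χ
⊑-¬≼-trans {φ} p q = inj₂ (φ , refl , ⊑-trans p (¬≼⇒⊑ q))

data Explained (r : SatF) (Θ : Branch) : SatF → Set where
  from-root   : ∀ {f} → QSub f r → Explained r Θ f
  from-acc    : ∀ {f} → IsAcc Θ f → Explained r Θ f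
  from-irrefl : ∀ {f} j → OccΘ j Θ → QSub f (j , ¬' ◇ nom j) → Explained r Θ f

Explained⇒⊎ : ∀ {r Θ f} → Explained r Θ f →
              QSub f r ⊎ IsAcc Θ f ⊎ Σ ℕ (λ j → OccΘ j Θ × QSub f (j , ¬' ◇ nom j))
Explained⇒⊎ (from-root q)        = inj₁ q
Explained⇒⊎ (from-acc a)         = inj₂ (inj₁ a)
Explained⇒⊎ (from-irrefl j o q) = inj₂ (inj₂ (j , o , q))

Explained-mono : ∀ {r Θ Θ' f} → Θ ⊆ Θ' → Explained r Θ f → Explained r Θ' f
Explained-mono Θ⊆Θ' (from-root q) = from-root q
Explained-mono Θ⊆Θ' (from-acc (i , j , φ , a , e)) = from-acc (i , j , φ , Θ⊆Θ' a , e)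
Explained-mono Θ⊆Θ' (from-irrefl j (k , ψ , m , o) q) =
  from-irrefl j (k , ψ , ⊆.map⁺ fml Θ⊆Θ' m , o) q

Explained-inherit : ∀ {r Θ k k' ψ ψ'} → (∀ {χ} → ψ ≼ χ → ψ' ≼ χ) → ¬ IsAcc Θ (k , ψ) →
                    Explained r Θ (k , ψ) → Explained r Θ (k' , ψ')
Explained-inherit down notAcc (from-root q)        = from-root (down q)
Explained-inherit down notAcc (from-acc a)         = ⊥-elim (notAcc a)
Explained-inherit down notAcc (from-irrefl j o q) = from-irrefl j o (down q)

ExplainedBranch : SatF → Branch → Set
ExplainedBranch r Θ = All (Explained r Θ ∘ fml) Θ

explained-∈ : ∀ {r Θ f} → ExplainedBranch r Θ → f ∈Θ Θ → Explained r Θ f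
explained-∈ E = All.lookup (All.map⁺ E)

¬IsAcc-¬ : ∀ {Θ k φ} → ¬ IsAcc Θ (k , ¬' φ)
¬IsAcc-¬ (_ , _ , _ , _ , ())

¬IsAcc-∧ : ∀ {Θ k φ ψ} → ¬ IsAcc Θ (k , φ ∧' ψ)
¬IsAcc-∧ (_ , _ , _ , _ , ())

¬IsAcc-at : ∀ {Θ k j φ} → ¬ IsAcc Θ (k , at j φ)
¬IsAcc-at (_ , _ , _ , _ , ())

Explained-++⁺ : ∀ {r Θ} ns {f} → Explained r Θ f → Explained r (Θ ++ ns) f
Explained-++⁺ {Θ = Θ} ns = Explained-mono (xs⊆xs++ys Θ ns)

explained-by-premise : ∀ {r Θ k k' ψ ψ'} ns → ExplainedBranch r Θ →
                       (k , ψ) ∈Θ Θ → ¬ IsAcc Θ (k , ψ) → (∀ {χ} → ψ ≼ χ → ψ' ≼ χ) →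
                       Explained r (Θ ++ ns) (k' , ψ')
explained-by-premise ns E p notAcc down =
  Explained-++⁺ ns (Explained-inherit down notAcc (explained-∈ E p))

conclusions-explained : ∀ {r Θ ns} → ExplainedBranch r Θ → Rule r Θ (one ns) →
                        All (Explained r (Θ ++ ns) ∘ fml) ns
conclusions-explained {ns = ns} E (r-¬¬ p) =
  explained-by-premise ns E p ¬IsAcc-¬ (⊑-≼-trans (⊑-¬ (⊑-¬ ⊑-refl))) ∷ []
conclusions-explained {ns = ns} E (r-∧ p) =
  explained-by-premise ns E p ¬IsAcc-∧ (⊑-≼-trans (⊑-∧ˡ ⊑-refl)) ∷
  explained-by-premise ns E p ¬IsAcc-∧ (⊑-≼-trans (⊑-∧ʳ ⊑-refl)) ∷ []
conclusions-explained {Θ = Θ} {ns} E (r-◇ {i} {j} {φ} p _ _ notAcc _) =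
  from-acc (i , j , φ , ∈-++⁺ʳ Θ (here refl) , refl) ∷
  explained-by-premise ns E p notAcc (⊑-≼-trans (⊑-◇ ⊑-refl)) ∷ []
conclusions-explained {ns = ns} E (r-¬◇ p _) =
  explained-by-premise ns E p ¬IsAcc-¬ (⊑-¬≼-trans (⊑-◇ ⊑-refl)) ∷ []
conclusions-explained {ns = ns} E (r-at p) =
  explained-by-premise ns E p ¬IsAcc-at (⊑-≼-trans (⊑-at ⊑-refl)) ∷ []
conclusions-explained {ns = ns} E (r-¬at p) =
  explained-by-premise ns E p ¬IsAcc-¬ (⊑-¬≼-trans (⊑-at ⊑-refl)) ∷ []
conclusions-explained {ns = ns} E (r-Id p _ notAcc) =
  explained-by-premise ns E p notAcc id ∷ []
conclusions-explained {ns = ns} E (r-Ref {i} o) =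
  Explained-++⁺ ns (from-irrefl i o (inj₁ (⊑-¬ (⊑-◇ ⊑-refl)))) ∷ []
conclusions-explained {ns = ns} E (r-□sym p _) =
  explained-by-premise ns E p ¬IsAcc-¬ (⊑-≼-trans (⊑-¬ (⊑-◇ (⊑-¬ ⊑-refl)))) ∷ []
conclusions-explained {ns = ns} E (r-I {i} o) =
  Explained-++⁺ ns (from-irrefl i o (inj₁ ⊑-refl)) ∷ []

split-explained : ∀ {r Θ f g} → ExplainedBranch r Θ → Rule r Θ (split f g) →
                  Explained r Θ f × Explained r Θ g
split-explained E (r-¬∧ p) =
  Explained-inherit (⊑-¬≼-trans (⊑-∧ˡ ⊑-refl)) ¬IsAcc-¬ (explained-∈ E p) ,
  Explained-inherit (⊑-¬≼-trans (⊑-∧ʳ ⊑-refl)) ¬IsAcc-¬ (explained-∈ E p)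

ExplainedBranch-++⁺ : ∀ {r Θ} ns → ExplainedBranch r Θ →
                      All (Explained r (Θ ++ ns) ∘ fml) ns → ExplainedBranch r (Θ ++ ns)
ExplainedBranch-++⁺ ns E E-ns = All.++⁺ (All.map (Explained-++⁺ ns) E) E-ns

Ext-explained : ∀ {r Θ Θ'} → ExplainedBranch r Θ → Ext r Θ Θ' → ExplainedBranch r Θ'
Ext-explained E (ext-one {ns} _ rule _) = ExplainedBranch-++⁺ ns E (conclusions-explained E rule)
Ext-explained E (ext-l _ rule _ _) =
  ExplainedBranch-++⁺ _ E (Explained-++⁺ _ (proj₁ (split-explained E rule)) ∷ [])
Ext-explained E (ext-r _ rule _ _) =
  ExplainedBranch-++⁺ _ E (Explained-++⁺ _ (proj₂ (split-explained E rule)) ∷ [])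

Path-explained : ∀ {r Θ} → Path r Θ → ExplainedBranch r Θ
Path-explained start      = from-root (inj₁ ⊑-refl) ∷ []
Path-explained (step P e) = Ext-explained (Path-explained P) e

-- The invariant holds on every path from the root.
lemma1 : ∀ (i : ℕ) (φ : Form) → ¬ Occurs i φ →
         ∀ (Θ : Branch) → IsBranch (i , φ) Θ →
         ∀ (k : ℕ) (ψ : Form) → (k , ψ) ∈Θ Θ →
         QSub (k , ψ) (i , φ)
         ⊎ IsAcc Θ (k , ψ)
         ⊎ Σ ℕ (λ j → OccΘ j Θ × QSub (k , ψ) (j , ¬' ◇ nom j))
lemma1 i φ _ Θ (path , _) k ψ = Explained⇒⊎ ∘ explained-∈ (Path-explained path)
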